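{- There is an absolute constant $C$ such that for any two graphs $G_1$ and $G_2$, each having a Hamiltonian path, $f(G_1 \square G_2) \le C\,(\log|V(G_1)| + \log|V(G_2)|)$.
   Context: $\log$ is base 2. All graphs are finite, simple, connected with at least 4 vertices. The Cartesian product $G_1\square G_2$ has vertex set $V(G_1)\times V(G_2)$, with $(v_1,v_2)$ adjacent to $(w_1,w_2)$ iff either $v_1=w_1$ and $v_2w_2\in E(G_2)$, or $v_2=w_2$ and $v_1w_1\in E(G_1)$. A path in a graph $G$ is a sequence of distinct vertices $v_0,\dots,v_r$ ($r\ge0$) with consecutive vertices adjacent. A vertex-separating path system of $G$ is a collection of distinct paths in $G$ such that for every pair of distinct vertices $u,v$ some path contains exactly one of $u,v$. $f(G)$ denotes the minimum size of such a system. -}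

module Defs where

open import Data.Nat using (ℕ)
open import Data.Fin using (Fin)
open import Data.List using (List; []; _∷_; length)
open import Data.List.Relation.Unary.Linked using (Linked)
open import Data.List.Relation.Unary.Any using (Any)
open import Data.List.Relation.Unary.Unique.Propositional using (Unique)
open import Data.List.Membership.Propositional using (_∈_; _∉_)
open import Data.Product using (_×_; _,_; ∃-syntax; Σ-syntax)
open import Data.Sum using (_⊎_)
open import Relation.Nullary using (¬_)
open import Relation.Binary.PropositionalEquality using (_≡_; _≢_)

record Graph (V : Set) : Set₁ where
  field
    Adj    : V → V → Set
    sym    : ∀ {u v} → Adj u v → Adj v u
    irrefl : ∀ {v} → ¬ Adj v v
open Graph public

_□_ : ∀ {V₁ V₂ : Set} → Graph V₁ → Graph V₂ → Graph (V₁ × V₂)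
Adj (G₁ □ G₂) (v₁ , v₂) (w₁ , w₂) =
  (v₁ ≡ w₁ × Adj G₂ v₂ w₂) ⊎ (v₂ ≡ w₂ × Adj G₁ v₁ w₁)
sym (G₁ □ G₂) (Data.Sum.inj₁ (Relation.Binary.PropositionalEquality.refl , a)) =
  Data.Sum.inj₁ (Relation.Binary.PropositionalEquality.refl , sym G₂ a)
sym (G₁ □ G₂) (Data.Sum.inj₂ (Relation.Binary.PropositionalEquality.refl , a)) =
  Data.Sum.inj₂ (Relation.Binary.PropositionalEquality.refl , sym G₁ a)
irrefl (G₁ □ G₂) (Data.Sum.inj₁ (_ , a)) = irrefl G₂ a
irrefl (G₁ □ G₂) (Data.Sum.inj₂ (_ , a)) = irrefl G₁ a

record IsPath {V : Set} (G : Graph V) (P : List V) : Set where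
  field
    nonempty : P ≢ []
    distinct : Unique P
    linked   : Linked (Adj G) P

Connected : ∀ {V : Set} → Graph V → Set
Connected {V} G = ∀ (u v : V) →
  ∃[ P ] ∃[ Q ] IsPath G (u ∷ P) × (u ∷ P ≡ Data.List._++_ Q (v ∷ []))

HasHamiltonianPath : ∀ {V : Set} → Graph V → Set
HasHamiltonianPath {V} G = ∃[ P ] IsPath G P × (∀ (v : V) → v ∈ P)

SeparatesBy : ∀ {V : Set} → V → V → List V → Set
SeparatesBy u v P = (u ∈ P × v ∉ P) ⊎ (v ∈ P × u ∉ P)

record IsVertexSeparatingPathSystem {V : Set} (G : Graph V) (S : List (List V)) : Set where
  field
    paths     : ∀ {P} → P ∈ S → IsPath G P
    distinct  : Unique S
    separates : ∀ (u v : V) → u ≢ v → Any (SeparatesBy u v) S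

-- f(G) ≤ k  (f(G) is the minimum size of a vertex-separating path system).
fAtMost : ∀ {V : Set} → Graph V → ℕ → Set
fAtMost {V} G k = Σ[ S ∈ List (List V) ] IsVertexSeparatingPathSystem G S × length S Data.Nat.≤ k

-- Enumerate V₁ and V₂ along their Hamiltonian paths, so that G₁ □ G₂ contains a grid whose
-- columns are indexed by V₁.  For a set A of columns, a snake runs through the columns in
-- path order, traversing every column of A completely (alternately forwards and backwards)
-- and touching every other column in a single vertex, on the row where it currently is.
-- Starting once at the first and once at the last row gives two paths which both contain
-- every vertex of a column in A, while they are always at opposite rows, so that no vertex
-- of another column lies on both.  Hence one of the two separates u from v whenever the
-- column of u is in A and that of v is not.  Letting A run over the ⌈log₂ n₁⌉ sets
-- {x | the k-th binary digit of toℕ x is 1} separates all pairs in distinct columns with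
-- 2 ⌈log₂ n₁⌉ paths; exchanging the factors handles pairs in a common column, so C = 2.
module Submission where

open import Defs
open import Data.Nat using (ℕ; zero; suc; _≤_; _<_; _+_; _*_; _^_; ⌊_/2⌋; ⌈_/2⌉; z≤n; s≤s; z<s)
open import Data.Nat.Properties
  using ( suc-injective; +-identityʳ; +-monoˡ-≤; +-mono-≤; *-suc; *-distribˡ-+; ≤-trans; ≤-reflexive
        ; <-≤-trans; m<1+n⇒m<n∨m≡n; ⌊n/2⌋-mono; ⌊n/2⌋≤⌈n/2⌉; ⌊n/2⌋+⌈n/2⌉≡n; ⌈n/2⌉<n; n≡⌈n+n/2⌉
        ; module ≤-Reasoning)
open import Data.Nat.Induction using (<-rec)
open import Data.Nat.Logarithm using (⌈log₂_⌉)
open import Data.Nat.Logarithm.Core using (⌈log2⌉-acc-irrelevant)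
open import Data.Bool using (Bool; true; false; if_then_else_)
import Data.Bool.Properties as Bool
open import Data.Fin using (Fin; toℕ)
import Data.Fin as Fin
import Data.Fin.Properties as Finₚ
open import Data.Maybe using (just)
import Data.Maybe as Maybe
open import Data.Maybe.Properties using (just-injective)
open import Data.Maybe.Relation.Binary.Connected using (just; just-nothing)
  renaming (Connected to MaybeConnected)
open import Data.List
  using (List; []; _∷_; _++_; _∷ʳ_; map; take; reverse; reverseAcc; head; last; length; deduplicate)
import Data.List.Properties as List
open import Data.List.Relation.Unary.Linked using (Linked; []; [-]; _∷_)
import Data.List.Relation.Unary.Linked as Linked
import Data.List.Relation.Unary.Linked.Properties as Linked
open import Data.List.Relation.Unary.Unique.Propositional using (Unique)
import Data.List.Relation.Unary.Unique.Propositional.Properties as Unique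
import Data.List.Relation.Unary.Unique.DecPropositional.Properties as UniqueDec
open import Data.List.Relation.Unary.AllPairs using ([]; _∷_)
open import Data.List.Relation.Unary.All using (All; []; _∷_)
import Data.List.Relation.Unary.All as All
import Data.List.Relation.Unary.All.Properties as All
open import Data.List.Relation.Unary.Any using (Any; here; there)
import Data.List.Relation.Unary.Any as Any
import Data.List.Relation.Unary.Any.Properties as Any
open import Data.List.Relation.Binary.Disjoint.Propositional using (Disjoint)
import Data.List.Relation.Binary.Permutation.Setoid as Permutation
import Data.List.Relation.Binary.Permutation.Setoid.Properties as Permutation
open import Data.List.Membership.Propositional using (_∈_; _∉_; find; lose)
import Data.List.Membership.DecPropositional as DecMembership
open import Data.List.Membership.Propositional.Properties
  using (∈-map⁺; ∈-map⁻; ∈-++⁺ˡ; ∈-++⁺ʳ; ∈-++⁻; ∈-deduplicate⁺; ∈-deduplicate⁻)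
open import Data.Product using (_×_; _,_; proj₁; proj₂; ∃-syntax; swap)
import Data.Product.Properties as Product
open import Data.Sum using (inj₁; inj₂)
import Data.Sum as Sum
open import Data.Empty using (⊥; ⊥-elim)
open import Relation.Binary.Definitions using (DecidableEquality)
open import Relation.Nullary using (yes; no)
open import Relation.Binary.PropositionalEquality using (_≡_; _≢_; refl; cong; trans; subst; setoid)
import Relation.Binary.PropositionalEquality as ≡

-- Binary codes of Fin n

⌈log₂[2+n]⌉≡1+⌈log₂⌈[2+n]/2⌉⌉ : ∀ n → ⌈log₂ suc (suc n) ⌉ ≡ suc ⌈log₂ ⌈ suc (suc n) /2⌉ ⌉
⌈log₂[2+n]⌉≡1+⌈log₂⌈[2+n]/2⌉⌉ n = cong suc (⌈log2⌉-acc-irrelevant (suc ⌈ n /2⌉))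

n≤2^⌈log₂n⌉ : ∀ n → n ≤ 2 ^ ⌈log₂ n ⌉
n≤2^⌈log₂n⌉ = <-rec _ bound
  where
  bound : ∀ n → (∀ {m} → m < n → m ≤ 2 ^ ⌈log₂ m ⌉) → n ≤ 2 ^ ⌈log₂ n ⌉
  bound 0 _ = z≤n
  bound 1 _ = s≤s z≤n
  bound n@(suc (suc k)) rec = begin
    n                    ≡⟨ ⌊n/2⌋+⌈n/2⌉≡n n ⟨
    ⌊ n /2⌋ + ⌈ n /2⌉    ≤⟨ +-monoˡ-≤ ⌈ n /2⌉ (⌊n/2⌋≤⌈n/2⌉ n) ⟩
    ⌈ n /2⌉ + ⌈ n /2⌉    ≤⟨ +-mono-≤ ih ih ⟩
    2 ^ L + 2 ^ L        ≡⟨ cong (2 ^ L +_) (+-identityʳ (2 ^ L)) ⟨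
    2 ^ suc L            ≡⟨ cong (2 ^_) (⌈log₂[2+n]⌉≡1+⌈log₂⌈[2+n]/2⌉⌉ k) ⟨
    2 ^ ⌈log₂ n ⌉        ∎
    where
    open ≤-Reasoning
    L = ⌈log₂ ⌈ n /2⌉ ⌉
    ih = rec (⌈n/2⌉<n k)

odd : ℕ → Bool
odd 0             = false
odd 1             = true
odd (suc (suc n)) = odd n

bit : ℕ → ℕ → Bool
bit zero    i = odd i
bit (suc k) i = bit k ⌊ i /2⌋

odd-⌊n/2⌋-injective : ∀ i j → odd i ≡ odd j → ⌊ i /2⌋ ≡ ⌊ j /2⌋ → i ≡ j
odd-⌊n/2⌋-injective 0             0             _ _ = refl
odd-⌊n/2⌋-injective 1             1             _ _ = refl
odd-⌊n/2⌋-injective (suc (suc i)) (suc (suc j)) o h =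
  cong (2 +_) (odd-⌊n/2⌋-injective i j o (suc-injective h))
odd-⌊n/2⌋-injective 0             1             () _
odd-⌊n/2⌋-injective 1             0             () _
odd-⌊n/2⌋-injective 0             (suc (suc _)) _ ()
odd-⌊n/2⌋-injective 1             (suc (suc _)) _ ()
odd-⌊n/2⌋-injective (suc (suc _)) 0             _ ()
odd-⌊n/2⌋-injective (suc (suc _)) 1             _ ()

m<2^[1+n]⇒⌊m/2⌋<2^n : ∀ {m} n → m < 2 ^ suc n → ⌊ m /2⌋ < 2 ^ n
m<2^[1+n]⇒⌊m/2⌋<2^n {m} n m< = begin-strict
  ⌊ m /2⌋                     <⟨ ⌊n/2⌋-mono (s≤s m<) ⟩
  ⌈ 2 ^ n + (2 ^ n + 0) /2⌉   ≡⟨ cong (λ k → ⌈ 2 ^ n + k /2⌉) (+-identityʳ (2 ^ n)) ⟩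
  ⌈ 2 ^ n + 2 ^ n /2⌉         ≡⟨ n≡⌈n+n/2⌉ (2 ^ n) ⟨
  2 ^ n                       ∎
  where open ≤-Reasoning

bit-separates : ∀ B {i j} → i < 2 ^ B → j < 2 ^ B → i ≢ j → ∃[ k ] k < B × bit k i ≢ bit k j
bit-separates zero    {0}     {0}     _        _        i≢j = ⊥-elim (i≢j refl)
bit-separates zero    {0}     {suc _} _        (s≤s ()) _
bit-separates zero    {suc _}         (s≤s ()) _        _
bit-separates (suc B) {i}     {j}     i<       j<       i≢j with odd i Bool.≟ odd j
... | no  odd≢ = 0 , z<s , odd≢
... | yes odd≡
  with bit-separates B (m<2^[1+n]⇒⌊m/2⌋<2^n B i<) (m<2^[1+n]⇒⌊m/2⌋<2^n B j<)
                       (λ ⌊/2⌋≡ → i≢j (odd-⌊n/2⌋-injective i j odd≡ ⌊/2⌋≡))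
...   | k , k<B , bit≢ = suc k , s≤s k<B , bit≢

InjectiveCode : ∀ {V : Set} → (ℕ → V → Bool) → ℕ → Set
InjectiveCode A B = ∀ {x y} → x ≢ y → ∃[ k ] k < B × A k x ≢ A k y

toℕ-bits-injectiveCode : ∀ n → InjectiveCode (λ k (x : Fin n) → bit k (toℕ x)) ⌈log₂ n ⌉
toℕ-bits-injectiveCode n {x} {y} x≢y =
  bit-separates ⌈log₂ n ⌉ (below x) (below y) (λ eq → x≢y (Finₚ.toℕ-injective eq))
  where
  below : ∀ (z : Fin n) → toℕ z < 2 ^ ⌈log₂ n ⌉
  below z = <-≤-trans (Finₚ.toℕ<n z) (n≤2^⌈log₂n⌉ n)

-- Paths and separating path families

Ends : ∀ {A : Set} → List A → A → A → Set
Ends xs s e = head xs ≡ just s × last xs ≡ just e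

last-∷ʳ : ∀ {A : Set} (xs : List A) x → last (xs ∷ʳ x) ≡ just x
last-∷ʳ []           x = refl
last-∷ʳ (_ ∷ [])     x = refl
last-∷ʳ (_ ∷ y ∷ xs) x = last-∷ʳ (y ∷ xs) x

last-reverse : ∀ {A : Set} (xs : List A) → last (reverse xs) ≡ head xs
last-reverse []       = refl
last-reverse (x ∷ xs) = trans (cong last (List.unfold-reverse x xs)) (last-∷ʳ (reverse xs) x)

head-reverse : ∀ {A : Set} (xs : List A) → head (reverse xs) ≡ last xs
head-reverse xs = trans (≡.sym (last-reverse (reverse xs))) (cong last (List.reverse-involutive xs))

last-∈ : ∀ {A : Set} (x : A) xs → ∃[ e ] last (x ∷ xs) ≡ just e × e ∈ x ∷ xs
last-∈ x []       = x , refl , here refl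
last-∈ x (y ∷ ys) with last-∈ y ys
... | e , eq , e∈ = e , eq , there e∈

reverse-ends : ∀ {A : Set} (xs : List A) {s e} → Ends xs s e → Ends (reverse xs) e s
reverse-ends xs (hd , lst) = trans (head-reverse xs) lst , trans (last-reverse xs) hd

head≢head-reverse : ∀ {A : Set} (xs : List A) {s e} → Ends xs s e → s ≢ e →
                    head xs ≢ head (reverse xs)
head≢head-reverse xs (hd , lst) s≢e eq =
  s≢e (just-injective (trans (≡.sym hd) (trans eq (trans (head-reverse xs) lst))))

distinct-ends : ∀ {A : Set} {xs : List A} {a b} → Unique xs → a ∈ xs → b ∈ xs → a ≢ b →
                ∃[ s ] ∃[ e ] Ends xs s e × s ≢ e
distinct-ends {xs = _ ∷ []}     _        (here refl) (here refl) a≢b = ⊥-elim (a≢b refl)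
distinct-ends {xs = x ∷ y ∷ ys} (x∉ ∷ _) _           _           _ with last-∈ y ys
... | e , eq , e∈ = x , e , (refl , eq) , All.lookup x∉ e∈

module _ {A : Set} {R : A → A → Set} where

  Linked-reverseAcc : ∀ {x xs acc} → Linked R (x ∷ xs) → Linked (λ a b → R b a) (x ∷ acc) →
                      Linked (λ a b → R b a) (reverseAcc (x ∷ acc) xs)
  Linked-reverseAcc [-]      racc = racc
  Linked-reverseAcc (r ∷ rs) racc = Linked-reverseAcc rs (r ∷ racc)

  Linked-reverse : ∀ {xs} → Linked R xs → Linked (λ a b → R b a) (reverse xs)
  Linked-reverse []        = []
  Linked-reverse l@[-]     = Linked-reverseAcc l [-]
  Linked-reverse l@(_ ∷ _) = Linked-reverseAcc l [-]

Unique-reverse : ∀ {A : Set} {xs : List A} → Unique xs → Unique (reverse xs)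
Unique-reverse {xs = xs} =
  Permutation.Unique-resp-↭ (setoid _) (Permutation.↭-sym (setoid _) (Permutation.↭-reverse (setoid _) xs))

reverse-isPath : ∀ {V : Set} {G : Graph V} {P} → IsPath G P → IsPath G (reverse P)
reverse-isPath {G = G} {P} p = record
  { nonempty = λ eq → IsPath.nonempty p (List.reverse-injective {x = P} {y = []} eq)
  ; distinct = Unique-reverse (IsPath.distinct p)
  ; linked   = Linked.map (sym G) (Linked-reverse (IsPath.linked p))
  }

swap-isPath : ∀ {V₁ V₂ : Set} {G₁ : Graph V₁} {G₂ : Graph V₂} {P} →
              IsPath (G₂ □ G₁) P → IsPath (G₁ □ G₂) (map swap P)
swap-isPath {P = P} p = record
  { nonempty = λ eq → IsPath.nonempty p (List.map-injective (cong swap) {P} {[]} eq)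
  ; distinct = Unique.map⁺ (cong swap) (IsPath.distinct p)
  ; linked   = Linked.map⁺ (Linked.map Sum.swap (IsPath.linked p))
  }

separatesBy-sym : ∀ {V : Set} {u v : V} {P} → SeparatesBy u v P → SeparatesBy v u P
separatesBy-sym = Sum.swap

map-separatesBy : ∀ {A B : Set} {f : A → B} → (∀ {x y} → f x ≡ f y → x ≡ y) →
                  ∀ {u v P} → SeparatesBy u v P → SeparatesBy (f u) (f v) (map f P)
map-separatesBy {f = f} f-inj = Sum.map separate-image separate-image
  where
  ∈-map-injective : ∀ {x xs} → f x ∈ map f xs → x ∈ xs
  ∈-map-injective fx∈ with ∈-map⁻ f fx∈
  ... | _ , w∈ , fx≡fw = subst (_∈ _) (≡.sym (f-inj fx≡fw)) w∈

  separate-image : ∀ {u v P} → u ∈ P × v ∉ P → f u ∈ map f P × f v ∉ map f P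
  separate-image (u∈ , v∉) = ∈-map⁺ f u∈ , λ fv∈ → v∉ (∈-map-injective fv∈)

fAtMost-deduplicate : ∀ {V : Set} {G : Graph V} {k} → DecidableEquality V → (S : List (List V)) →
                      All (IsPath G) S → (∀ u v → u ≢ v → Any (SeparatesBy u v) S) →
                      length S ≤ k → fAtMost G k
fAtMost-deduplicate _≟_ S paths separates |S|≤k =
  deduplicate _≟ₗ_ S ,
  record
    { paths     = λ P∈ → All.lookup paths (∈-deduplicate⁻ _≟ₗ_ S P∈)
    ; distinct  = UniqueDec.deduplicate-! _≟ₗ_ S
    ; separates = λ u v u≢v → keep (find (separates u v u≢v))
    } ,
  ≤-trans (List.length-deduplicate _≟ₗ_ S) |S|≤k
  where
  _≟ₗ_ = List.≡-dec _≟_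
  keep : ∀ {Q : List _ → Set} → ∃[ P ] P ∈ S × Q P → Any Q (deduplicate _≟ₗ_ S)
  keep (P , P∈ , QP) = lose (∈-deduplicate⁺ _≟ₗ_ P∈) QP

-- Snakes

module Snake {V₁ V₂ : Set} (G₁ : Graph V₁) (G₂ : Graph V₂) where

  column : V₁ → List V₂ → List (V₁ × V₂)
  column x = map (x ,_)

  -- The snake stands at the head of cur; a full column takes it to the head of other.
  snake : (V₁ → Bool) → List V₂ → List V₂ → List V₁ → List (V₁ × V₂)
  snake A cur other []       = []
  snake A cur other (x ∷ xs) =
    if A x then column x cur ++ snake A other cur xs
           else column x (take 1 cur) ++ snake A cur other xs

  ∈-column : ∀ {x x' y L} → (x , y) ∈ column x' L → x ≡ x' × y ∈ L
  ∈-column p with ∈-map⁻ (_ ,_) p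
  ... | _ , y∈ , refl = refl , y∈

  ∈-take-1 : ∀ {y} {L : List V₂} → y ∈ take 1 L → head L ≡ just y
  ∈-take-1 {L = _ ∷ _} (here refl) = refl

  fst-∈-column-++ : ∀ {x x' y L rest xs} → (x , y) ∈ column x' L ++ rest →
                    ((x , y) ∈ rest → x ∈ xs) → x ∈ x' ∷ xs
  fst-∈-column-++ {L = L} p rest⇒ with ∈-++⁻ (column _ L) p
  ... | inj₁ p' = here (proj₁ (∈-column p'))
  ... | inj₂ p' = there (rest⇒ p')

  fst-∈-snake : ∀ A {cur other x y} xs → (x , y) ∈ snake A cur other xs → x ∈ xs
  fst-∈-snake A (x' ∷ xs) p with A x'
  ... | true  = fst-∈-column-++ p (fst-∈-snake A xs)
  ... | false = fst-∈-column-++ p (fst-∈-snake A xs)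

  head-snake : ∀ A {cur other x s} xs → head cur ≡ just s →
               head (snake A cur other (x ∷ xs)) ≡ just (x , s)
  head-snake A {_ ∷ _} {x = x} xs refl with A x
  ... | true  = refl
  ... | false = refl

  column-linked : ∀ {x L} → Linked (Adj G₂) L → Linked (Adj (G₁ □ G₂)) (column x L)
  column-linked l = Linked.map⁺ (Linked.map (λ a → inj₁ (refl , a)) l)

  last-column : ∀ {x e} L → last L ≡ just e → last (column x L) ≡ just (x , e)
  last-column {x} L eq = trans (List.last-map (x ,_) L) (cong (Maybe.map (x ,_)) eq)

  connected-to-snake : ∀ A {cur other x s} xs → Linked (Adj G₁) (x ∷ xs) → head cur ≡ just s →
                       MaybeConnected (Adj (G₁ □ G₂)) (just (x , s)) (head (snake A cur other xs))
  connected-to-snake A []       _       _  = just-nothing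
  connected-to-snake A (_ ∷ xs) (a ∷ _) hd =
    subst (MaybeConnected _ _) (≡.sym (head-snake A xs hd)) (just (inj₂ (refl , a)))

  snake-linked : ∀ A {cur other s e} xs → Linked (Adj G₂) cur → Linked (Adj G₂) other →
                 Ends cur s e → Ends other e s → Linked (Adj G₁) xs →
                 Linked (Adj (G₁ □ G₂)) (snake A cur other xs)
  snake-linked A []       _  _  _ _ _ = []
  snake-linked A {cur@(_ ∷ _)} (x ∷ xs) lc lo (refl , lst) eo lx with A x
  ... | true  = Linked.++⁺ (column-linked lc)
                  (subst (λ m → MaybeConnected _ m _) (≡.sym (last-column cur lst))
                         (connected-to-snake A xs lx (proj₁ eo)))
                  (snake-linked A xs lo lc eo (refl , lst) (Linked.tail lx))
  ... | false = Linked.++⁺ [-] (connected-to-snake A xs lx refl)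
                  (snake-linked A xs lc lo (refl , lst) eo (Linked.tail lx))

  column-unique : ∀ {x L} → Unique L → Unique (column x L)
  column-unique = Unique.map⁺ Product.,-injectiveʳ

  column-disjoint : ∀ A {cur other x L} xs → x ∉ xs → Disjoint (column x L) (snake A cur other xs)
  column-disjoint A xs x∉ (p∈column , p∈snake) with ∈-map⁻ _ p∈column
  ... | _ , _ , refl = x∉ (fst-∈-snake A xs p∈snake)

  snake-unique : ∀ A {cur other} xs → Unique cur → Unique other → Unique xs →
                 Unique (snake A cur other xs)
  snake-unique A []       _  _  _         = []
  snake-unique A (x ∷ xs) uc uo (x∉ ∷ ux) with A x
  ... | true  = Unique.++⁺ (column-unique uc) (snake-unique A xs uo uc ux)
                           (column-disjoint A xs (All.All¬⇒¬Any x∉))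
  ... | false = Unique.++⁺ (column-unique (Unique.take⁺ 1 uc)) (snake-unique A xs uc uo ux)
                           (column-disjoint A xs (All.All¬⇒¬Any x∉))

  snake-isPath : ∀ A {cur other s e} xs → IsPath G₂ cur → IsPath G₂ other →
                 Ends cur s e → Ends other e s → IsPath G₁ xs →
                 IsPath (G₁ □ G₂) (snake A cur other xs)
  snake-isPath A xs pc po ec eo px = record
    { nonempty = nonempty xs (IsPath.nonempty px)
    ; distinct = snake-unique A xs (IsPath.distinct pc) (IsPath.distinct po) (IsPath.distinct px)
    ; linked   = snake-linked A xs (IsPath.linked pc) (IsPath.linked po) ec eo (IsPath.linked px)
    }
    where
    nonempty : ∀ xs → xs ≢ [] → snake A _ _ xs ≢ []
    nonempty []       xs≢[] _  = xs≢[] refl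
    nonempty (x ∷ xs) _     eq with trans (≡.sym (head-snake A xs (proj₁ ec))) (cong head eq)
    ... | ()

  snake-covers : ∀ A {cur other x y} xs → A x ≡ true → x ∈ xs → y ∈ cur → y ∈ other →
                 (x , y) ∈ snake A cur other xs
  snake-covers A (x ∷ xs) Ax (here refl) y∈c _ rewrite Ax = ∈-++⁺ˡ (∈-map⁺ (x ,_) y∈c)
  snake-covers A (x' ∷ xs) Ax (there x∈) y∈c y∈o with A x'
  ... | true  = ∈-++⁺ʳ _ (snake-covers A xs Ax x∈ y∈o y∈c)
  ... | false = ∈-++⁺ʳ _ (snake-covers A xs Ax x∈ y∈c y∈o)

  false-true-apart : ∀ {A : V₁ → Bool} {x x'} → A x ≡ false → A x' ≡ true → x ≢ x'
  false-true-apart Ax Ax' refl with trans (≡.sym Ax) Ax'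
  ... | ()

  snake-excludes : ∀ A {cur other x y} xs → A x ≡ false → Unique xs → head cur ≢ head other →
                   (x , y) ∈ snake A cur other xs → (x , y) ∈ snake A other cur xs → ⊥
  snake-excludes A {cur} {other} (x' ∷ xs) Ax (x'∉ ∷ ux) heads≢ p q with A x' in Ax'
  ... | true with ∈-++⁻ (column x' cur) p | ∈-++⁻ (column x' other) q
  ...   | inj₁ p' | _       = false-true-apart Ax Ax' (proj₁ (∈-column p'))
  ...   | inj₂ _  | inj₁ q' = false-true-apart Ax Ax' (proj₁ (∈-column q'))
  ...   | inj₂ p' | inj₂ q' = snake-excludes A xs Ax ux (λ eq → heads≢ (≡.sym eq)) p' q'
  snake-excludes A {cur} {other} (x' ∷ xs) Ax (x'∉ ∷ ux) heads≢ p q | false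
    with ∈-++⁻ (column x' (take 1 cur)) p | ∈-++⁻ (column x' (take 1 other)) q
  ... | inj₁ p' | inj₁ q' =
    heads≢ (trans (∈-take-1 (proj₂ (∈-column p'))) (≡.sym (∈-take-1 (proj₂ (∈-column q')))))
  ... | inj₁ p' | inj₂ q' = All.lookup x'∉ (fst-∈-snake A xs q') (≡.sym (proj₁ (∈-column p')))
  ... | inj₂ p' | inj₁ q' = All.lookup x'∉ (fst-∈-snake A xs p') (≡.sym (proj₁ (∈-column q')))
  ... | inj₂ p' | inj₂ q' = snake-excludes A xs Ax ux heads≢ p' q'

  zigzags : (V₁ → Bool) → List V₁ → List V₂ → List (List (V₁ × V₂))
  zigzags A xs ys = snake A ys (reverse ys) xs ∷ snake A (reverse ys) ys xs ∷ []

  zigzags-paths : ∀ A {xs ys s e} → IsPath G₁ xs → IsPath G₂ ys → Ends ys s e →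
                  All (IsPath (G₁ □ G₂)) (zigzags A xs ys)
  zigzags-paths A {xs} {ys} px py ey =
      snake-isPath A xs py (reverse-isPath py) ey (reverse-ends ys ey) px
    ∷ snake-isPath A xs (reverse-isPath py) py (reverse-ends ys ey) ey px
    ∷ []

  zigzags-separate : DecidableEquality (V₁ × V₂) → ∀ A {xs ys s e u₁ u₂ v₁ v₂} →
                     Unique xs → Ends ys s e → s ≢ e → u₁ ∈ xs → u₂ ∈ ys →
                     A u₁ ≡ true → A v₁ ≡ false →
                     Any (SeparatesBy (u₁ , u₂) (v₁ , v₂)) (zigzags A xs ys)
  zigzags-separate _≟_ A {xs} {ys} {v₁ = v₁} {v₂} ux ey s≢e u₁∈ u₂∈ Au Av
    with DecMembership._∈?_ _≟_ (v₁ , v₂) (snake A ys (reverse ys) xs)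
  ... | yes v∈ = there (here (inj₁ (snake-covers A xs Au u₁∈ (Any.reverse⁺ u₂∈) u₂∈ ,
                                   snake-excludes A xs Av ux (head≢head-reverse ys ey s≢e) v∈)))
  ... | no  v∉ = here (inj₁ (snake-covers A xs Au u₁∈ u₂∈ (Any.reverse⁺ u₂∈) , v∉))

module Snakes {V₁ V₂ : Set} {G₁ : Graph V₁} {G₂ : Graph V₂} {xs : List V₁} {ys : List V₂} {s e : V₂}
  (px : IsPath G₁ xs) (xs-spans : ∀ x → x ∈ xs)
  (py : IsPath G₂ ys) (ys-spans : ∀ y → y ∈ ys) (ey : Ends ys s e) (s≢e : s ≢ e) where

  open Snake G₁ G₂

  snakes : (ℕ → V₁ → Bool) → ℕ → List (List (V₁ × V₂))
  snakes A zero    = []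
  snakes A (suc k) = zigzags (A k) xs ys ++ snakes A k

  length-snakes : ∀ A B → length (snakes A B) ≡ 2 * B
  length-snakes A zero    = refl
  length-snakes A (suc B) = trans (cong (2 +_) (length-snakes A B)) (≡.sym (*-suc 2 B))

  snakes-paths : ∀ A B → All (IsPath (G₁ □ G₂)) (snakes A B)
  snakes-paths A zero    = []
  snakes-paths A (suc B) = All.++⁺ (zigzags-paths (A B) px py ey) (snakes-paths A B)

  Any-snakes : ∀ {P : List (V₁ × V₂) → Set} A B {k} → k < B →
               Any P (zigzags (A k) xs ys) → Any P (snakes A B)
  Any-snakes A (suc B) k<1+B p with m<1+n⇒m<n∨m≡n k<1+B
  ... | inj₁ k<B  = Any.++⁺ʳ _ (Any-snakes A B k<B p)
  ... | inj₂ refl = Any.++⁺ˡ p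

  zigzags-separate-spanning : DecidableEquality (V₁ × V₂) → ∀ A {u₁ u₂ v₁ v₂} →
                              A u₁ ≡ true → A v₁ ≡ false →
                              Any (SeparatesBy (u₁ , u₂) (v₁ , v₂)) (zigzags A xs ys)
  zigzags-separate-spanning _≟_ A {u₁} {u₂} =
    zigzags-separate _≟_ A (IsPath.distinct px) ey s≢e (xs-spans u₁) (ys-spans u₂)

  snakes-separate : DecidableEquality (V₁ × V₂) → ∀ {A B} → InjectiveCode A B →
                    ∀ {u v} → proj₁ u ≢ proj₁ v → Any (SeparatesBy u v) (snakes A B)
  snakes-separate _≟_ {A} {B} code {u₁ , _} {v₁ , _} u₁≢v₁ with code u₁≢v₁
  ... | k , k<B , Au≢Av with A k u₁ in Au | A k v₁ in Av
  ...   | true  | false = Any-snakes A B k<B (zigzags-separate-spanning _≟_ (A k) Au Av)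
  ...   | false | true  =
    Any-snakes A B k<B (Any.map separatesBy-sym (zigzags-separate-spanning _≟_ (A k) Av Au))
  ...   | true  | true  = ⊥-elim (Au≢Av refl)
  ...   | false | false = ⊥-elim (Au≢Av refl)

-- The product bound

product-fAtMost : ∀ {V₁ V₂ : Set} {G₁ : Graph V₁} {G₂ : Graph V₂} →
                  DecidableEquality V₁ → DecidableEquality V₂ →
                  ∀ {A₁ B₁ A₂ B₂} → InjectiveCode A₁ B₁ → InjectiveCode A₂ B₂ →
                  HasHamiltonianPath G₁ → HasHamiltonianPath G₂ →
                  ∀ {a₁ b₁ : V₁} {a₂ b₂ : V₂} → a₁ ≢ b₁ → a₂ ≢ b₂ →
                  fAtMost (G₁ □ G₂) (2 * (B₁ + B₂))
product-fAtMost {G₁ = G₁} {G₂} _≟₁_ _≟₂_ {A₁} {B₁} {A₂} {B₂} code₁ code₂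
                (xs , px , xs-spans) (ys , py , ys-spans) a₁≢b₁ a₂≢b₂
  with distinct-ends (IsPath.distinct px) (xs-spans _) (xs-spans _) a₁≢b₁
     | distinct-ends (IsPath.distinct py) (ys-spans _) (ys-spans _) a₂≢b₂
... | _ , _ , ex , s₁≢e₁ | _ , _ , ey , s₂≢e₂ =
  fAtMost-deduplicate (Product.≡-dec _≟₁_ _≟₂_) S paths separates (≤-reflexive |S|≡)
  where
  module S₁ = Snakes px xs-spans py ys-spans ey s₂≢e₂
  module S₂ = Snakes py ys-spans px xs-spans ex s₁≢e₁
  S₁ = S₁.snakes A₁ B₁
  S₂ = S₂.snakes A₂ B₂
  S  = S₁ ++ map (map swap) S₂

  paths : All (IsPath (G₁ □ G₂)) S
  paths = All.++⁺ (S₁.snakes-paths A₁ B₁) (All.map⁺ (All.map swap-isPath (S₂.snakes-paths A₂ B₂)))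

  separates : ∀ u v → u ≢ v → Any (SeparatesBy u v) S
  separates u v u≢v with proj₁ u ≟₁ proj₁ v
  ... | no  u₁≢v₁ = Any.++⁺ˡ (S₁.snakes-separate (Product.≡-dec _≟₁_ _≟₂_) code₁ u₁≢v₁)
  ... | yes u₁≡v₁ = Any.++⁺ʳ S₁ (Any.map⁺ (Any.map (map-separatesBy (cong swap))
                      (S₂.snakes-separate (Product.≡-dec _≟₂_ _≟₁_) code₂ u₂≢v₂)))
    where
    u₂≢v₂ : proj₂ u ≢ proj₂ v
    u₂≢v₂ u₂≡v₂ = u≢v (Product.×-≡,≡→≡ (u₁≡v₁ , u₂≡v₂))

  |S|≡ : length S ≡ 2 * (B₁ + B₂)
  |S|≡ = begin
    length (S₁ ++ map (map swap) S₂)        ≡⟨ List.length-++ S₁ ⟩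
    length S₁ + length (map (map swap) S₂)  ≡⟨ cong (length S₁ +_) (List.length-map (map swap) S₂) ⟩
    length S₁ + length S₂                   ≡⟨ ≡.cong₂ _+_ (S₁.length-snakes A₁ B₁) (S₂.length-snakes A₂ B₂) ⟩
    2 * B₁ + 2 * B₂                         ≡⟨ *-distribˡ-+ 2 B₁ B₂ ⟨
    2 * (B₁ + B₂)                           ∎
    where open ≡.≡-Reasoning

corollary23 : ∃[ C ] (∀ {n₁ n₂ : ℕ} (G₁ : Graph (Fin n₁)) (G₂ : Graph (Fin n₂))
    → 4 ≤ n₁ → 4 ≤ n₂ → Connected G₁ → Connected G₂
    → HasHamiltonianPath G₁ → HasHamiltonianPath G₂
    → fAtMost (G₁ □ G₂) (C * (⌈log₂ n₁ ⌉ + ⌈log₂ n₂ ⌉)))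
corollary23 = 2 , λ { {n₁} {n₂} G₁ G₂ (s≤s (s≤s _)) (s≤s (s≤s _)) _ _ ham₁ ham₂ →
  product-fAtMost Finₚ._≟_ Finₚ._≟_ (toℕ-bits-injectiveCode n₁) (toℕ-bits-injectiveCode n₂) ham₁ ham₂
                  {Fin.zero} {Fin.suc Fin.zero} {Fin.zero} {Fin.suc Fin.zero} (λ ()) (λ ()) }
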